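{- Let $v\ge4$, $d\ge1$ and $D\in\mathcal{D}_{v,d}(132,321)$. Then $\pi_D$ has at most one descent, and if $\pi_D$ has a descent, the label $1$ is one of the two entries forming that descent.
   Context: A diamond with $v$ vertices ($v\ge4$) is the poset with a least element, a greatest element, and $v-2$ pairwise incomparable middle elements (in a fixed left-to-right order) strictly between them. $\mathcal{D}_{v,d}$ is the set of labellings of $d$ diamonds (placed left to right) by $1,\dots,vd$, each label used once, such that in each diamond least label $<$ each middle label $<$ greatest label. For $D\in\mathcal{D}_{v,d}$, $\pi_D$ is the permutation obtained by reading the diamonds left to right and, within each diamond, the least element, then the middle elements left to right, then the greatest element. $\mathcal{D}_{v,d}(P)$ is the set of $D$ with $\pi_D$ avoiding every classical pattern in $P$. A descent of $\pi$ is a pair of adjacent entries $\pi_i>\pi_{i+1}$. -}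

module Defs where

open import Data.Nat using (ℕ; suc; _+_; _*_; _<_)
open import Data.Fin using (Fin) renaming (_<_ to _<ᶠ_)
open import Data.List using (List; []; _∷_; _++_; [_]; length; lookup; upTo; map; concatMap)
open import Data.List.Relation.Unary.All using (All)
open import Data.List.Relation.Binary.Permutation.Propositional using (_↭_)
open import Data.Vec using (Vec; toList)
open import Data.Product using (Σ; _×_; _,_; ∃)
open import Relation.Nullary using (¬_)
open import Function.Bundles using (_⇔_)
open import Relation.Binary.PropositionalEquality using (_≡_)

-- A labelled diamond with m middle elements (so v = m + 2 vertices):
-- (least label , middle labels left to right , greatest label).
Diamond : ℕ → Set
Diamond m = ℕ × Vec ℕ m × ℕ

readDiamond : {m : ℕ} → Diamond m → List ℕ
readDiamond (a , ms , b) = a ∷ (toList ms ++ [ b ])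

πD : {m d : ℕ} → Vec (Diamond m) d → List ℕ
πD ds = concatMap readDiamond (toList ds)

DiamondOrdered : {m : ℕ} → Diamond m → Set
DiamondOrdered (a , ms , b) = All (λ x → a < x × x < b) (toList ms)

-- D ∈ 𝒟_{v,d} with v = m + 2 : labels 1..vd each used once, and each diamond ordered.
IsDiamondLabelling : (m d : ℕ) → Vec (Diamond m) d → Set
IsDiamondLabelling m d ds =
  (πD ds ↭ map suc (upTo ((m + 2) * d))) × All DiamondOrdered (toList ds)

Contains : List ℕ → List ℕ → Set
Contains π σ =
  Σ (Fin (length σ) → Fin (length π)) λ f →
    (∀ a b → a <ᶠ b → f a <ᶠ f b) ×
    (∀ a b → (lookup σ a < lookup σ b) ⇔ (lookup π (f a) < lookup π (f b)))

Avoids : List ℕ → List ℕ → Set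
Avoids π σ = ¬ Contains π σ

-- a descent of π at position (length xs): π = xs ++ a ∷ b ∷ ys with a > b
DescentAt : List ℕ → List ℕ → ℕ → ℕ → List ℕ → Set
DescentAt π xs a b ys = (π ≡ xs ++ a ∷ b ∷ ys) × b < a

-- If a descent a > b of π had b > 1, the entry 1 would lie either before the
-- descent, giving 1 a b ≅ 132, or after it, giving a b 1 ≅ 321. So every
-- descent ends at the entry 1, and since labels are distinct, all descents sit
-- at the same position.
module Submission where

open import Defs
open import Relation.Binary.PropositionalEquality using (_≡_; refl; sym; trans; cong; module ≡-Reasoning; subst; subst₂; setoid)
open import Data.Nat using (ℕ; suc; _≤_; _<_; z≤n; s≤s; z<s; s<s)
open import Data.Nat.Properties using (<-trans; <-irrefl; <-asym; suc-injective; m≤n⇒m<n∨m≡n)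
open import Data.Fin using (Fin) renaming (zero to fzero; suc to fsuc; _<_ to _<ᶠ_)
open import Data.List using (List; []; _∷_; _++_; [_]; length; lookup; map; upTo)
open import Data.List.Properties using (++-assoc; ∷-injective; ∷ʳ-injectiveˡ)
open import Data.List.Relation.Unary.All as All using (All)
open import Data.List.Relation.Unary.All.Properties using (All¬⇒¬Any)
open import Data.List.Relation.Unary.Any using (here; there)
open import Data.List.Relation.Unary.Unique.Propositional using (Unique)
open import Data.List.Relation.Unary.Unique.Propositional.Properties using (map⁺; upTo⁺)
open import Data.List.Relation.Unary.AllPairs using (_∷_)
open import Data.List.Membership.Propositional using (_∈_)
open import Data.List.Membership.Propositional.Properties using (∈-++⁻; ∈-++⁺ʳ; ∈-map⁺; ∈-map⁻; ∈-upTo⁺)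
open import Data.List.Relation.Binary.Sublist.Propositional using (_⊆_; _∷_; _∷ʳ_; minimum; from∈)
open import Data.List.Relation.Binary.Sublist.Propositional.Properties using (++⁺; ++⁺ˡ)
open import Data.List.Relation.Binary.Permutation.Propositional using (_↭_; ↭-sym; ↭⇒↭ₛ)
open import Data.List.Relation.Binary.Permutation.Propositional.Properties using (∈-resp-↭)
open import Data.List.Relation.Binary.Permutation.Setoid.Properties (setoid ℕ) using (Unique-resp-↭)
open import Data.Vec using (Vec)
open import Data.Product using (_×_; _,_)
open import Data.Sum using (_⊎_; inj₁; inj₂)
open import Relation.Nullary using (¬_; contradiction)
open import Function.Base using (_∘_)
open import Function.Bundles using (_⇔_; mk⇔)

private
  variable
    a a′ b b′ m v c : ℕ
    π σ xs xs′ ys ys′ p q p′ q′ : List ℕ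

embed : xs ⊆ ys → Fin (length xs) → Fin (length ys)
embed (_ ∷ʳ xs⊆ys) i        = fsuc (embed xs⊆ys i)
embed (_ ∷ xs⊆ys)  fzero    = fzero
embed (_ ∷ xs⊆ys)  (fsuc i) = fsuc (embed xs⊆ys i)

embed-mono : (xs⊆ys : xs ⊆ ys) → ∀ i j → i <ᶠ j → embed xs⊆ys i <ᶠ embed xs⊆ys j
embed-mono (_ ∷ʳ xs⊆ys) i        j        i<j       = s<s (embed-mono xs⊆ys i j i<j)
embed-mono (_ ∷ xs⊆ys)  fzero    (fsuc j) _         = z<s
embed-mono (_ ∷ xs⊆ys)  (fsuc i) (fsuc j) (s≤s i<j) = s<s (embed-mono xs⊆ys i j i<j)

lookup-embed : (xs⊆ys : xs ⊆ ys) → ∀ i → lookup ys (embed xs⊆ys i) ≡ lookup xs i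
lookup-embed (_ ∷ʳ xs⊆ys) i        = lookup-embed xs⊆ys i
lookup-embed (refl ∷ _)   fzero    = refl
lookup-embed (_ ∷ xs⊆ys)  (fsuc i) = lookup-embed xs⊆ys i

Contains-⊆ : xs ⊆ ys → Contains xs σ → Contains ys σ
Contains-⊆ {xs} {ys} {σ} xs⊆ys (f , f-mono , f-iso) = g , g-mono , g-iso
  where
  g : Fin (length σ) → Fin (length ys)
  g i = embed xs⊆ys (f i)

  g-mono : ∀ i j → i <ᶠ j → g i <ᶠ g j
  g-mono i j i<j = embed-mono xs⊆ys (f i) (f j) (f-mono i j i<j)

  g-iso : ∀ i j → (lookup σ i < lookup σ j) ⇔ (lookup ys (g i) < lookup ys (g j))
  g-iso i j = subst₂ (λ x y → (lookup σ i < lookup σ j) ⇔ (x < y))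
    (sym (lookup-embed xs⊆ys (f i))) (sym (lookup-embed xs⊆ys (f j))) (f-iso i j)

Agree : ℕ → ℕ → ℕ → ℕ → Set
Agree s s′ t t′ = (s < s′ × t < t′) ⊎ (s′ < s × t′ < t)

Agree-sym : ∀ {s s′ t t′} → Agree s s′ t t′ → Agree s′ s t′ t
Agree-sym (inj₁ p) = inj₂ p
Agree-sym (inj₂ p) = inj₁ p

Agree⇒⇔ : ∀ {s s′ t t′} → Agree s s′ t t′ → (s < s′ ⇔ t < t′)
Agree⇒⇔ (inj₁ (s<s′ , t<t′)) = mk⇔ (λ _ → t<t′) (λ _ → s<s′)
Agree⇒⇔ (inj₂ (s′<s , t′<t)) = mk⇔ (contradiction s′<s ∘ <-asym) (contradiction t′<t ∘ <-asym)

irrefl⇔ : ∀ {s t} → (s < s ⇔ t < t)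
irrefl⇔ = mk⇔ (λ s<s → contradiction s<s (<-irrefl refl)) (λ t<t → contradiction t<t (<-irrefl refl))

Contains-triple : ∀ {s₀ s₁ s₂ t₀ t₁ t₂} → Agree s₀ s₁ t₀ t₁ → Agree s₀ s₂ t₀ t₂ → Agree s₁ s₂ t₁ t₂ →
                  Contains (t₀ ∷ t₁ ∷ t₂ ∷ []) (s₀ ∷ s₁ ∷ s₂ ∷ [])
Contains-triple {s₀} {s₁} {s₂} {t₀} {t₁} {t₂} a₀₁ a₀₂ a₁₂ = (λ i → i) , (λ _ _ i<j → i<j) , iso
  where
  iso : ∀ i j → (lookup (s₀ ∷ s₁ ∷ s₂ ∷ []) i < lookup (s₀ ∷ s₁ ∷ s₂ ∷ []) j)
              ⇔ (lookup (t₀ ∷ t₁ ∷ t₂ ∷ []) i < lookup (t₀ ∷ t₁ ∷ t₂ ∷ []) j)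
  iso fzero               fzero               = irrefl⇔
  iso fzero               (fsuc fzero)        = Agree⇒⇔ a₀₁
  iso fzero               (fsuc (fsuc fzero)) = Agree⇒⇔ a₀₂
  iso (fsuc fzero)        fzero               = Agree⇒⇔ (Agree-sym a₀₁)
  iso (fsuc fzero)        (fsuc fzero)        = irrefl⇔
  iso (fsuc fzero)        (fsuc (fsuc fzero)) = Agree⇒⇔ a₁₂
  iso (fsuc (fsuc fzero)) fzero               = Agree⇒⇔ (Agree-sym a₀₂)
  iso (fsuc (fsuc fzero)) (fsuc fzero)        = Agree⇒⇔ (Agree-sym a₁₂)
  iso (fsuc (fsuc fzero)) (fsuc (fsuc fzero)) = irrefl⇔

Contains-132 : m < b → b < a → Contains (m ∷ a ∷ b ∷ []) (1 ∷ 3 ∷ 2 ∷ [])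
Contains-132 m<b b<a = Contains-triple
  (inj₁ (s<s z<s , <-trans m<b b<a)) (inj₁ (s<s z<s , m<b)) (inj₂ (s<s (s<s z<s) , b<a))

Contains-321 : m < b → b < a → Contains (a ∷ b ∷ m ∷ []) (3 ∷ 2 ∷ 1 ∷ [])
Contains-321 m<b b<a = Contains-triple
  (inj₂ (s<s (s<s z<s) , b<a)) (inj₂ (s<s z<s , <-trans m<b b<a)) (inj₂ (s<s z<s , m<b))

descent-bottom≡minimum : Avoids π (1 ∷ 3 ∷ 2 ∷ []) → Avoids π (3 ∷ 2 ∷ 1 ∷ []) →
                         m ∈ π → All (m ≤_) π → DescentAt π xs a b ys → b ≡ m
descent-bottom≡minimum {m = m} {xs} {a} {b} {ys} av132 av321 m∈π m≤π (refl , b<a)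
  with m≤n⇒m<n∨m≡n (All.lookup m≤π (∈-++⁺ʳ xs (there (here refl))))
... | inj₂ m≡b = sym m≡b
... | inj₁ m<b with ∈-++⁻ xs m∈π
...   | inj₁ m∈xs =
  contradiction (Contains-⊆ (++⁺ (from∈ m∈xs) (refl ∷ refl ∷ minimum ys)) (Contains-132 m<b b<a)) av132
...   | inj₂ (here refl) = contradiction (<-trans m<b b<a) (<-irrefl refl)
...   | inj₂ (there (here refl)) = contradiction m<b (<-irrefl refl)
...   | inj₂ (there (there m∈ys)) =
  contradiction (Contains-⊆ (++⁺ˡ xs (refl ∷ refl ∷ from∈ m∈ys)) (Contains-321 m<b b<a)) av321

Unique-head∉tail : Unique (v ∷ q) → ¬ (v ∷ q ≡ c ∷ p′ ++ v ∷ q′)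
Unique-head∉tail {p′ = p′} (v∉q ∷ _) eq with refl , q≡ ← ∷-injective eq =
  All¬⇒¬Any v∉q (subst (_ ∈_) (sym q≡) (∈-++⁺ʳ p′ (here refl)))

Unique-prefix : Unique (p ++ v ∷ q) → p ++ v ∷ q ≡ p′ ++ v ∷ q′ → p ≡ p′
Unique-prefix {[]}    {p′ = []}     _       _  = refl
Unique-prefix {[]}    {p′ = _ ∷ _}  u       eq = contradiction eq (Unique-head∉tail u)
Unique-prefix {_ ∷ _} {p′ = []}     u       eq = contradiction (sym eq) (Unique-head∉tail (subst Unique eq u))
Unique-prefix {_ ∷ p} {p′ = _ ∷ p′} (_ ∷ u) eq with refl , eq′ ← ∷-injective eq =
  cong (_ ∷_) (Unique-prefix {p} u eq′)

Unique⇒descents-coincide : Unique π → DescentAt π xs a b ys → DescentAt π xs′ a′ b′ ys′ →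
                           b ≡ b′ → xs ≡ xs′
Unique⇒descents-coincide {xs = xs} {a} {b} {ys} {xs′} {a′} {ys′ = ys′} u (refl , _) (eq , _) refl =
  ∷ʳ-injectiveˡ xs xs′ (Unique-prefix (subst Unique (sym (++-assoc xs [ a ] _)) u) split-eq)
  where
  split-eq : (xs ++ [ a ]) ++ b ∷ ys ≡ (xs′ ++ [ a′ ]) ++ b ∷ ys′
  split-eq = begin
    (xs ++ [ a ]) ++ b ∷ ys    ≡⟨ ++-assoc xs [ a ] _ ⟩
    xs ++ a ∷ b ∷ ys           ≡⟨ eq ⟩
    xs′ ++ a′ ∷ b ∷ ys′        ≡⟨ ++-assoc xs′ [ a′ ] _ ⟨
    (xs′ ++ [ a′ ]) ++ b ∷ ys′ ∎
    where open ≡-Reasoning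

module PermutationOf1⋯ {n : ℕ} (π↭ : π ↭ map suc (upTo n)) where

  unique : Unique π
  unique = Unique-resp-↭ (↭⇒↭ₛ (↭-sym π↭)) (map⁺ suc-injective (upTo⁺ n))

  positive : All (1 ≤_) π
  positive = All.tabulate entry≥1
    where
    entry≥1 : ∀ {x} → x ∈ π → 1 ≤ x
    entry≥1 x∈π with _ , _ , refl ← ∈-map⁻ suc (∈-resp-↭ π↭ x∈π) = s≤s z≤n

  1∈ : 0 < n → 1 ∈ π
  1∈ 0<n = ∈-resp-↭ (↭-sym π↭) (∈-map⁺ suc (∈-upTo⁺ 0<n))

lemma3p7 : (m d : ℕ) → 2 ≤ m → 1 ≤ d → (D : Vec (Diamond m) d) →
    IsDiamondLabelling m d D →
    Avoids (πD D) (1 ∷ 3 ∷ 2 ∷ []) → Avoids (πD D) (3 ∷ 2 ∷ 1 ∷ []) →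
    ((xs ys xs′ ys′ : List ℕ) (a b a′ b′ : ℕ) →
        DescentAt (πD D) xs a b ys → DescentAt (πD D) xs′ a′ b′ ys′ →
        length xs ≡ length xs′)
    × ((xs ys : List ℕ) (a b : ℕ) → DescentAt (πD D) xs a b ys → (a ≡ 1 ⊎ b ≡ 1))
-- Matching the bounds makes the length (m + 2) * d of πD D reduce to a successor.
lemma3p7 _ _ (s≤s (s≤s _)) (s≤s _) D (πD↭ , _) av132 av321 = single-descent , descent-at-1
  where
  open PermutationOf1⋯ πD↭

  bottom≡1 : ∀ {xs a b ys} → DescentAt (πD D) xs a b ys → b ≡ 1
  bottom≡1 = descent-bottom≡minimum av132 av321 (1∈ z<s) positive

  single-descent : ∀ xs ys xs′ ys′ a b a′ b′ → DescentAt (πD D) xs a b ys →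
                   DescentAt (πD D) xs′ a′ b′ ys′ → length xs ≡ length xs′
  single-descent _ _ _ _ _ _ _ _ d d′ =
    cong length (Unique⇒descents-coincide unique d d′ (trans (bottom≡1 d) (sym (bottom≡1 d′))))

  descent-at-1 : ∀ xs ys a b → DescentAt (πD D) xs a b ys → a ≡ 1 ⊎ b ≡ 1
  descent-at-1 _ _ _ _ d = inj₂ (bottom≡1 d)
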